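{- (i) Let $\mathcal{A}$ be an S-ring over a finite abelian group $G$ and $X$ a basic set of $\mathcal{A}$. If $X$ contains two elements of coprime orders, then $X$ is rational, i.e. $\{x^m:x\in X\}=X$ for every integer $m$ coprime to $\exp(G)$. (ii) Let $G$ be a finite abelian group whose order is divisible by at least two distinct primes and let $\mathcal{A}$ be an S-ring over $G$. If the rational closure $\mathcal{A}\cap W(G)$ has rank $2$, then $\mathcal{A}$ has rank $2$.
   Context: An S-ring over $G$ is a subring $\mathcal{A}\subseteq\mathbb{Z}G$ spanned by $\underline{X}=\sum_{x\in X}x$ for $X$ in a partition of $G$ (basic sets) containing $\{e\}$ and closed under $X\mapsto X^{ -1}$; its rank is the number of basic sets. $\mathcal{P}(G)$ is the group of power automorphisms $x\mapsto x^m$ with $\gcd(m,\exp(G))=1$, and $W(G)$ is the S-ring whose basic sets are the orbits of $\mathcal{P}(G)$ on $G$. The intersection $\mathcal{A}\cap W(G)$ is again an S-ring over $G$ (the rational closure). -}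

module Defs where

open import Level using (0ℓ)
open import Data.Nat using (ℕ; zero; suc; _<_; _≤_)
open import Data.Nat.Coprimality using (Coprime)
open import Data.Integer using (ℤ; +_; -[1+_]; ∣_∣)
open import Data.Fin using (Fin)
import Data.Fin as F
open import Data.List using (List; length; filter; cartesianProduct)
open import Data.List.Membership.Propositional using (_∈_)
open import Data.List.Relation.Unary.Unique.Propositional using (Unique)
open import Data.Product using (Σ; ∃; _×_; _,_)
open import Algebra.Structures using (IsAbelianGroup)
open import Relation.Binary.PropositionalEquality using (_≡_)
open import Relation.Binary.Definitions using (DecidableEquality)
open import Relation.Nullary.Decidable using (_×-dec_)

record FinAbGroup : Set₁ where
  infixl 7 _∙_
  field
    Carrier        : Set
    _∙_            : Carrier → Carrier → Carrier
    ε              : Carrier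
    _⁻¹            : Carrier → Carrier
    isAbelianGroup : IsAbelianGroup _≡_ _∙_ ε _⁻¹
    _≟_            : DecidableEquality Carrier
    elems          : List Carrier
    complete       : ∀ x → x ∈ elems
    unique         : Unique elems

  order : ℕ
  order = length elems

  _^_ : Carrier → ℕ → Carrier
  x ^ zero  = ε
  x ^ suc n = x ∙ (x ^ n)

  _^ℤ_ : Carrier → ℤ → Carrier
  x ^ℤ (+ n)    = x ^ n
  x ^ℤ -[1+ n ] = (x ⁻¹) ^ suc n

  IsElemOrder : Carrier → ℕ → Set
  IsElemOrder x k = (0 < k) × (x ^ k ≡ ε) × (∀ j → 0 < j → x ^ j ≡ ε → k ≤ j)

  IsExponent : ℕ → Set
  IsExponent e = (0 < e) × (∀ x → x ^ e ≡ ε)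
               × (∀ j → 0 < j → (∀ x → x ^ j ≡ ε) → e ≤ j)

  -- Structure constant: number of pairs (x , y) ∈ X_i × X_j with x y = z,
  -- for the partition of G given by the labelling κ : G → Fin r.
  -- This is the coefficient of z in X̲_i X̲_j in ℤG.
  structConst : {r : ℕ} → (Carrier → Fin r) → Fin r → Fin r → Carrier → ℕ
  structConst κ i j z =
    length (filter (λ p → (κ (Data.Product.proj₁ p) F.≟ i)
                          ×-dec ((κ (Data.Product.proj₂ p) F.≟ j)
                          ×-dec ((Data.Product.proj₁ p ∙ Data.Product.proj₂ p) ≟ z)))
                   (cartesianProduct elems elems))

  -- Power-map relation: y = x^m for some integer m coprime to exp(G) = e,
  -- i.e. y lies in the P(G)-orbit of x (basic sets of W(G)).
  PowerRel : ℕ → Carrier → Carrier → Set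
  PowerRel e x y = Σ ℤ λ m → Coprime ∣ m ∣ e × (y ≡ x ^ℤ m)

open FinAbGroup public

-- Its basic sets are the (nonempty) fibres of the
-- labelling `basic : G → Fin rank`, so `rank` is the number of basic sets.
-- The ℤ-span of the X̲ is closed under multiplication iff, for all basic
-- sets X_i, X_j, the coefficient of z in X̲_i X̲_j is constant on each basic set.
record SRing (G : FinAbGroup) : Set where
  field
    rank           : ℕ
    basic          : Carrier G → Fin rank
    basic-surj     : ∀ i → ∃ λ x → basic x ≡ i
    identity-basic : ∀ x → basic x ≡ basic (ε G) → x ≡ ε G
    inverse-closed : ∀ x y → basic x ≡ basic y → basic (_⁻¹ G x) ≡ basic (_⁻¹ G y)
    mult-closed    : ∀ i j z z' → basic z ≡ basic z' →
                     structConst G basic i j z ≡ structConst G basic i j z'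

open SRing public

IsRational : {G : FinAbGroup} → (A : SRing G) → ℕ → Fin (rank A) → Set
IsRational {G} A e i =
  ∀ (m : ℤ) → Coprime ∣ m ∣ e →
    (∀ x → basic A x ≡ i → basic A (_^ℤ_ G x m) ≡ i)
    × (∀ y → basic A y ≡ i → ∃ λ x → (basic A x ≡ i) × (_^ℤ_ G x m ≡ y))

-- The partition of A ∩ W(G): the join of the partition of A and the
-- partition into P(G)-orbits (equivalence relation generated by both).
data Join {G : FinAbGroup} (A : SRing G) (e : ℕ) : Carrier G → Carrier G → Set where
  join-A     : ∀ {x y} → basic A x ≡ basic A y → Join A e x y
  join-W     : ∀ {x y} → PowerRel G e x y → Join A e x y
  join-sym   : ∀ {x y} → Join A e x y → Join A e y x
  join-trans : ∀ {x y z} → Join A e x y → Join A e y z → Join A e x z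

NumClasses : (G : FinAbGroup) → (Carrier G → Carrier G → Set) → ℕ → Set
NumClasses G R k =
  Σ (Carrier G → Fin k) λ f →
    (∀ i → ∃ λ x → f x ≡ i)
    × (∀ x y → f x ≡ f y → R x y)
    × (∀ x y → R x y → f x ≡ f y)

RationalClosureRank : {G : FinAbGroup} → SRing G → ℕ → ℕ → Set
RationalClosureRank {G} A e k = NumClasses G (Join A e) k

{-# OPTIONS --safe #-}
module Submission where

-- Everything rests on Schur's theorem on multipliers: for k coprime to exp(G), x ↦ x^k maps each
-- basic set of A into a basic set. By the Frobenius congruence X̲^p ≡ X̲^(p) (mod p) in the group
-- semiring ℕ[G], the 0/1-valued function X̲^(p) is congruent mod p to X̲^p ∈ A, hence constant on
-- basic sets; so the inverse of x ↦ x^p modulo exp(G) is a multiplier, and modulo exp(G) every k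
-- coprime to exp(G) is a product of such inverses.
--
-- (i) If x, y ∈ X have coprime orders a and b, the Chinese remainder theorem gives m coprime to
-- exp(G) with m ≡ k (mod a) and m ≡ 1 (mod b). Then x^k = x^m and y = y^m lie in one basic set,
-- so X^(k) ⊆ X for every such k, whence X^(k) = X.
--
-- (ii) If A ∩ W(G) has rank 2, its basic sets are {e} and G ∖ {e}. Cauchy's theorem (the same
-- congruence applied to G̲ at e: #{x | x^p = e} ≡ |G|^(p-1) ≡ 0) gives x, y of distinct prime
-- orders; being joined, some x^k with k coprime to exp(G) lies in the basic set X of y, so X is
-- rational by (i). Every w ≠ e is joined to y, i.e. lies in the basic set of some y^l, which is X.
-- Hence the basic sets of A are {e} and X.

open import Defs hiding (_∙_; ε; _⁻¹; _^_; _^ℤ_; _≟_)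
open import Data.Nat using (ℕ)
open import Data.Nat.Coprimality using (Coprime)
open import Data.Nat.Divisibility using (_∣_)
open import Data.Nat.Primality using (Prime)
open import Data.Fin using (Fin)
open import Data.Product using (Σ; ∃; _×_)
open import Relation.Binary.PropositionalEquality using (_≡_; _≢_)

open import Level using (Level; 0ℓ)
open import Function using (_∘_; const)
open import Data.Empty using (⊥-elim)
open import Data.Sum using (_⊎_; inj₁; inj₂; [_,_])
open import Data.Product using (_,_; proj₁; proj₂; ∃₂)
open import Relation.Nullary using (¬_; contradiction)
open import Relation.Binary.PropositionalEquality
  using (refl; sym; trans; cong; cong₂; subst; _≗_; module ≡-Reasoning)
  renaming (isEquivalence to ≡-isEquivalence)
import Data.Nat as ℕ
import Data.Integer.Base as ℤ
open import Data.Fin using (zero; suc; toℕ; inject₁; fromℕ)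
import Data.Fin as Fin
open import Data.Fin.Properties using (toℕ-fromℕ; inject₁ℕ<; injective⇒≤)
open import Data.Nat.Primality
  using (euclidsLemma; prime⇒nonZero; prime⇒nonTrivial; prime⇒irreducible; ¬prime[0]; ¬prime[1])
open import Algebra.Bundles using (CommutativeSemiring; AbelianGroup)
open import Algebra.Structures.Biased using (isCommutativeSemiringˡ; isCommutativeMonoidˡ)
import Algebra.Construct.Pointwise as Pointwise

-- The arithmetic operators of ℕ are opened only after FreshmansDream, whose semiring reuses their names.
module _ where
  open import Data.Nat.Base using (zero; suc; _<_; _*_; _∸_; _!)
  open import Data.Nat.Properties using (<⇒≱; <⇒≤; <-trans; n<1+n; ∸-monoʳ-<; _!*_!≢0)
  open import Data.Nat.Divisibility using (_∤_; ∣1⇒≡1; ∣⇒≤; m∣m*n)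
  open import Data.Nat.DivMod using (m/n*n≡m)
  open import Data.Nat.Combinatorics using (_C_; nCk≡n!/k![n-k]!; k![n∸k]!∣n!)

  prime∤! : ∀ {p} → Prime p → ∀ {n} → n < p → p ∤ n !
  prime∤! pp {zero}  _   p∣1  = ¬prime[1] (subst Prime (∣1⇒≡1 p∣1) pp)
  prime∤! pp {suc n} n<p p∣n! with euclidsLemma (suc n) (n !) pp p∣n!
  ... | inj₁ p∣1+n = <⇒≱ n<p (∣⇒≤ p∣1+n)
  ... | inj₂ p∣n!  = prime∤! pp (<-trans (n<1+n n) n<p) p∣n!

  prime∣nCk : ∀ {p k} → Prime p → 0 < k → k < p → p ∣ p C k
  prime∣nCk {p@(suc q)} {k} pp 0<k k<p
    with euclidsLemma (p C k) (k ! * (p ∸ k) !) pp p∣nCk*d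
    where
    instance _ = k !* (p ∸ k) !≢0
    nCk*d≡p! : (p C k) * (k ! * (p ∸ k) !) ≡ p !
    nCk*d≡p! = trans (cong (_* (k ! * (p ∸ k) !)) (nCk≡n!/k![n-k]! (<⇒≤ k<p)))
                     (m/n*n≡m (k![n∸k]!∣n! (<⇒≤ k<p)))
    p∣nCk*d : p ∣ (p C k) * (k ! * (p ∸ k) !)
    p∣nCk*d = subst (p ∣_) (sym nCk*d≡p!) (m∣m*n (q !))
  ... | inj₁ p∣nCk = p∣nCk
  ... | inj₂ p∣d with euclidsLemma (k !) ((p ∸ k) !) pp p∣d
  ...   | inj₁ p∣k!   = contradiction p∣k! (prime∤! pp k<p)
  ...   | inj₂ p∣p-k! = contradiction p∣p-k! (prime∤! pp (∸-monoʳ-< 0<k (<⇒≤ k<p)))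

module FreshmansDream {c ℓ} (S : CommutativeSemiring c ℓ) where

  open CommutativeSemiring S
    using (_≈_; _+_; _*_; 0#; 1#; setoid; semiring; +-monoid; +-commutativeMonoid; +-commutativeSemigroup;
           +-cong; +-congˡ; +-identityˡ; *-identityˡ; *-identityʳ)
    renaming (Carrier to R; refl to ≈-refl; sym to ≈-sym; trans to ≈-trans)
  open import Algebra.Properties.CommutativeSemiring.Binomial S using (theorem; binomialTerm)
  open import Algebra.Properties.Semiring.Exp semiring using (_^_)
  open import Algebra.Properties.Semiring.Sum semiring using (sum; sum-init-last)
  open import Algebra.Properties.Monoid.Mult +-monoid using (×-assocˡ; ×-homo-1)
    renaming (_×_ to _·_)
  open import Algebra.Properties.CommutativeMonoid.Mult +-commutativeMonoid using (×-distrib-+)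
  open import Algebra.Properties.CommutativeSemigroup +-commutativeSemigroup using (x∙yz≈zx∙y)
  open import Data.Vec.Functional using (Vector; tail; init; last)
  open import Relation.Binary.Reasoning.Setoid setoid
  open import Data.Nat.Base using (_∸_; z<s; s<s)
  open import Data.Nat.Properties using (n∸n≡0; *-comm)
  open import Data.Nat.Combinatorics using (_C_; nCn≡1)
  open import Data.Nat.Divisibility using (divides)

  ·-zeroʳ : ∀ n → n · 0# ≈ 0#
  ·-zeroʳ ℕ.zero    = ≈-refl
  ·-zeroʳ (ℕ.suc n) = ≈-trans (+-identityˡ _) (·-zeroʳ n)

  sum-multiples : ∀ n {m} (t : Vector R m) → (∀ k → ∃ λ w → t k ≈ n · w) →
                  ∃ λ w → sum t ≈ n · w
  sum-multiples n {ℕ.zero}  t mult = 0# , ≈-sym (·-zeroʳ n)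
  sum-multiples n {ℕ.suc m} t mult with mult zero | sum-multiples n (tail t) (mult ∘ suc)
  ... | w₀ , t₀≈ | w , rest≈ = w₀ + w , ≈-trans (+-cong t₀≈ rest≈) (≈-sym (×-distrib-+ w₀ w n))

  freshmansDream : ∀ {p} → Prime p → ∀ x y → ∃ λ w → (x + y) ^ p ≈ (x ^ p + y ^ p) + p · w
  freshmansDream {ℕ.suc q} pp x y = proj₁ middle , (begin
    (x + y) ^ p                                     ≈⟨ theorem p x y ⟩
    t zero + sum (tail t)                           ≈⟨ +-congˡ (sum-init-last (tail t)) ⟩
    t zero + (sum (init (tail t)) + last (tail t))  ≈⟨ +-cong firstTerm (+-cong (proj₂ middle) lastTerm) ⟩
    y ^ p + (p · proj₁ middle + x ^ p)              ≈⟨ x∙yz≈zx∙y (y ^ p) _ (x ^ p) ⟩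
    (x ^ p + y ^ p) + p · proj₁ middle              ∎)
    where
    p = ℕ.suc q
    t = binomialTerm x y p
    firstTerm : t zero ≈ y ^ p
    firstTerm = ≈-trans (×-homo-1 _) (*-identityˡ _)
    termAt : ∀ k {j} → toℕ k ≡ j → t k ≈ (p C j) · (x ^ j * y ^ (p ∸ j))
    termAt k refl = ≈-refl
    lastTerm : last (tail t) ≈ x ^ p
    lastTerm = begin
      last (tail t)                    ≈⟨ termAt (suc (fromℕ q)) (cong ℕ.suc (toℕ-fromℕ q)) ⟩
      (p C p) · (x ^ p * y ^ (p ∸ p))  ≡⟨ cong₂ (λ c n → c · (x ^ p * y ^ n)) (nCn≡1 p) (n∸n≡0 p) ⟩
      1 · (x ^ p * 1#)                 ≈⟨ ×-homo-1 _ ⟩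
      x ^ p * 1#                       ≈⟨ *-identityʳ _ ⟩
      x ^ p                            ∎
    middleTerm : ∀ k → ∃ λ w → init (tail t) k ≈ p · w
    middleTerm k with prime∣nCk pp z<s (s<s (inject₁ℕ< k))
    ... | divides c eq = c · b , (begin
      (p C j) · b    ≡⟨ cong (_· b) (trans eq (*-comm c p)) ⟩
      (p ℕ.* c) · b  ≈⟨ ×-assocˡ b p c ⟨
      p · (c · b)    ∎)
      where
      j = ℕ.suc (toℕ (inject₁ k))
      b = x ^ j * y ^ (p ∸ j)
    middle = sum-multiples p (init (tail t)) middleTerm

open import Data.Nat.Base
  using ( zero; suc; pred; _+_; _*_; _∸_; _≤_; _<_; z≤n; s≤s; z<s; s<s; NonZero
        ; >-nonZero; >-nonZero⁻¹; ≢-nonZero; ≢-nonZero⁻¹; n>1⇒nonTrivial; nonTrivial⇒n>1 )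
open import Data.Nat.Properties
  using ( +-assoc; +-comm; +-identityʳ; *-assoc; *-comm; *-identityˡ; *-identityʳ; *-zeroʳ; *-distribˡ-+
        ; ^-zeroˡ; suc-pred; ≤-antisym; <-≤-trans; ≤-<-trans; ≤⇒≯; ≮⇒≥; _<?_; +-0-isCommutativeMonoid )
open import Data.Nat.DivMod using (_%_; _/_; [m+kn]%n≡m%n; m<n⇒m%n≡m; m≡m%n+[m/n]*n; m%n<n)
open import Data.Nat.Divisibility
  using ( divides; n∣m*n; m∣m*n; ∣m⇒∣m*n; ∣n⇒∣m*n; ∣1⇒≡1; ∣-trans; ∣m+n∣m⇒∣n; ∣m∣n⇒∣m+n
        ; m%n≡0⇒n∣m; quotient≢0; quotient-<; m∣n⇒n≡m*quotient )
open import Data.Nat.GCD using (gcd; gcd[m,n]∣m; gcd[m,n]∣n; gcd[m,n]≡0⇒m≡0; module Bézout)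
import Data.Nat.Coprimality as Coprime
open import Data.Nat.Coprimality
  using (coprime?; coprime-divisor; coprime-Bézout; gcd≡1⇒coprime; prime⇒coprime; 0-coprimeTo-m⇒m≡1)
open import Data.Nat.Primality.Factorisation using (factorise; module PrimeFactorisation)
open import Data.Nat.ListAction using (product)
open import Data.Nat.Induction using (<-rec)
open import Data.Nat.Tactic.RingSolver using (solve-∀)
open import Data.List using (List; []; _∷_; length; filter; map; _++_; cartesianProduct; allFin)
open import Data.List.Membership.Propositional using (_∈_; lose)
open import Data.List.Membership.Propositional.Properties using (∈-allFin)
open import Data.List.Relation.Unary.Any using (here; there; any?; satisfied)
open import Data.List.Relation.Unary.All using (All; _∷_)
import Data.List.Relation.Unary.All as All
open import Data.List.Relation.Unary.AllPairs using (_∷_)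
open import Data.List.Relation.Unary.Unique.Propositional using (Unique)
open import Data.List.Relation.Unary.Unique.Propositional.Properties using (allFin⁺)
open import Relation.Nullary using (Dec; yes; no; ¬?)
open import Relation.Nullary.Decidable using (_×-dec_)
open import Relation.Unary using (Decidable)
open import Relation.Binary.Definitions using (DecidableEquality)

private
  variable
    a p : Level
    A B : Set a
    P Q : Set p

∑ : List A → (A → ℕ) → ℕ
∑ []       f = 0
∑ (x ∷ xs) f = f x + ∑ xs f

syntax ∑ xs (λ x → t) = ∑[ x ∈ xs ] t

∑-cong : ∀ xs {f g : A → ℕ} → (∀ x → f x ≡ g x) → ∑ xs f ≡ ∑ xs g
∑-cong []       f≗g = refl
∑-cong (x ∷ xs) f≗g = cong₂ _+_ (f≗g x) (∑-cong xs f≗g)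

∑-distrib-+ : ∀ xs (f g : A → ℕ) → ∑[ x ∈ xs ] (f x + g x) ≡ ∑ xs f + ∑ xs g
∑-distrib-+ []       f g = refl
∑-distrib-+ (x ∷ xs) f g rewrite ∑-distrib-+ xs f g = interchange (f x) (g x) (∑ xs f) (∑ xs g)
  where
  interchange : ∀ a b c d → (a + b) + (c + d) ≡ (a + c) + (b + d)
  interchange = solve-∀

*-distribˡ-∑ : ∀ c xs (f : A → ℕ) → c * ∑ xs f ≡ ∑[ x ∈ xs ] (c * f x)
*-distribˡ-∑ c []       f = *-zeroʳ c
*-distribˡ-∑ c (x ∷ xs) f = trans (*-distribˡ-+ c (f x) _) (cong (c * f x +_) (*-distribˡ-∑ c xs f))

*-distribʳ-∑ : ∀ c xs (f : A → ℕ) → ∑ xs f * c ≡ ∑[ x ∈ xs ] (f x * c)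
*-distribʳ-∑ c xs f = trans (*-comm _ c) (trans (*-distribˡ-∑ c xs f) (∑-cong xs (λ x → *-comm c (f x))))

∑-const : ∀ (xs : List A) c → ∑[ x ∈ xs ] c ≡ length xs * c
∑-const []       c = refl
∑-const (x ∷ xs) c = cong (c +_) (∑-const xs c)

∑-zero : ∀ (xs : List A) → ∑[ x ∈ xs ] 0 ≡ 0
∑-zero xs = trans (∑-const xs 0) (*-zeroʳ (length xs))

∑-comm : ∀ xs ys (f : A → B → ℕ) →
         ∑[ x ∈ xs ] ∑[ y ∈ ys ] f x y ≡ ∑[ y ∈ ys ] ∑[ x ∈ xs ] f x y
∑-comm []       ys f = sym (∑-zero ys)
∑-comm (x ∷ xs) ys f = trans (cong (∑ ys (f x) +_) (∑-comm xs ys f)) (sym (∑-distrib-+ ys (f x) _))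

∑-*-exchange : ∀ xs ys (a : A → ℕ) (b : B → ℕ) (c : A → B → ℕ) →
  ∑[ x ∈ xs ] (a x * ∑[ y ∈ ys ] (b y * c x y)) ≡ ∑[ y ∈ ys ] (b y * ∑[ x ∈ xs ] (a x * c x y))
∑-*-exchange xs ys a b c = begin
  ∑[ x ∈ xs ] (a x * ∑[ y ∈ ys ] (b y * c x y))    ≡⟨ ∑-cong xs (λ x → *-distribˡ-∑ (a x) ys _) ⟩
  ∑[ x ∈ xs ] ∑[ y ∈ ys ] (a x * (b y * c x y))    ≡⟨ ∑-comm xs ys _ ⟩
  ∑[ y ∈ ys ] ∑[ x ∈ xs ] (a x * (b y * c x y))    ≡⟨ ∑-cong ys (λ y → ∑-cong xs λ x → swap-left (a x) (b y) _) ⟩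
  ∑[ y ∈ ys ] ∑[ x ∈ xs ] (b y * (a x * c x y))    ≡⟨ ∑-cong ys (λ y → *-distribˡ-∑ (b y) xs _) ⟨
  ∑[ y ∈ ys ] (b y * ∑[ x ∈ xs ] (a x * c x y))    ∎
  where
  open ≡-Reasoning
  swap-left : ∀ x y z → x * (y * z) ≡ y * (x * z)
  swap-left = solve-∀

∑-++ : ∀ (xs ys : List A) f → ∑ (xs ++ ys) f ≡ ∑ xs f + ∑ ys f
∑-++ []       ys f = refl
∑-++ (x ∷ xs) ys f = trans (cong (f x +_) (∑-++ xs ys f)) (sym (+-assoc (f x) _ _))

∑-map : ∀ (g : A → B) xs f → ∑ (map g xs) f ≡ ∑[ x ∈ xs ] f (g x)
∑-map g []       f = refl
∑-map g (x ∷ xs) f = cong (f (g x) +_) (∑-map g xs f)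

∑-cartesianProduct : ∀ (xs : List A) (ys : List B) f →
                     ∑ (cartesianProduct xs ys) f ≡ ∑[ x ∈ xs ] ∑[ y ∈ ys ] f (x , y)
∑-cartesianProduct []       ys f = refl
∑-cartesianProduct (x ∷ xs) ys f =
  trans (∑-++ (map (x ,_) ys) _ f) (cong₂ _+_ (∑-map (x ,_) ys f) (∑-cartesianProduct xs ys f))

χ : Dec P → ℕ
χ (yes _) = 1
χ (no _)  = 0

χ-cong : (P → Q) → (Q → P) → (P? : Dec P) (Q? : Dec Q) → χ P? ≡ χ Q?
χ-cong P→Q Q→P (yes p) (yes q) = refl
χ-cong P→Q Q→P (yes p) (no ¬q) = contradiction (P→Q p) ¬q
χ-cong P→Q Q→P (no ¬p) (yes q) = contradiction (Q→P q) ¬p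
χ-cong P→Q Q→P (no ¬p) (no ¬q) = refl

χ-×-dec : (P? : Dec P) (Q? : Dec Q) → χ (P? ×-dec Q?) ≡ χ P? * χ Q?
χ-×-dec (yes _) (yes _) = refl
χ-×-dec (yes _) (no _)  = refl
χ-×-dec (no _)  _       = refl

χ-^ : (P? : Dec P) → ∀ n → χ P? ℕ.^ suc n ≡ χ P?
χ-^ (yes _) n = ^-zeroˡ (suc n)
χ-^ (no _)  n = refl

χ-yes : P → (P? : Dec P) → χ P? ≡ 1
χ-yes _   (yes _) = refl
χ-yes pr (no ¬pr) = contradiction pr ¬pr

χ≡1⇒ : (P? : Dec P) → χ P? ≡ 1 → P
χ≡1⇒ (yes p) _ = p

χ<2 : (P? : Dec P) → χ P? < 2
χ<2 (yes _) = s≤s (s≤s z≤n)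
χ<2 (no _)  = s≤s z≤n

length-filter : ∀ {P : A → Set p} (P? : Decidable P) xs → length (filter P? xs) ≡ ∑[ x ∈ xs ] χ (P? x)
length-filter P? []       = refl
length-filter P? (x ∷ xs) with P? x
... | yes _ = cong suc (length-filter P? xs)
... | no _  = length-filter P? xs

module _ (_≟_ : DecidableEquality A) where

  ∑-δ : ∀ {xs} (F : A → ℕ) {a} → Unique xs → a ∈ xs → ∑[ x ∈ xs ] (χ (a ≟ x) * F x) ≡ F a
  ∑-δ {x ∷ xs} F {a} (a∉xs ∷ _) (here refl) with a ≟ a
  ... | yes _ = trans (cong₂ _+_ (*-identityˡ (F a)) (∑-δ-∉ xs (λ a∈xs → All.lookup a∉xs a∈xs refl)))
                      (+-identityʳ _)
    where
    ∑-δ-∉ : ∀ ys → ¬ a ∈ ys → ∑[ y ∈ ys ] (χ (a ≟ y) * F y) ≡ 0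
    ∑-δ-∉ []       _    = refl
    ∑-δ-∉ (y ∷ ys) a∉ys with a ≟ y
    ... | yes refl = contradiction (here refl) a∉ys
    ... | no _     = ∑-δ-∉ ys (a∉ys ∘ there)
  ... | no a≢a = contradiction refl a≢a
  ∑-δ {x ∷ xs} F {a} (x∉xs ∷ unique) (there a∈xs) with a ≟ x
  ... | yes refl = contradiction refl (All.lookup x∉xs a∈xs)
  ... | no _     = ∑-δ F unique a∈xs

infix 4 _≡_mod_

_≡_mod_ : ℕ → ℕ → ℕ → Set
a ≡ b mod n = ∃₂ λ i j → a + i * n ≡ b + j * n

≡⇒≡mod : ∀ {a b n} → a ≡ b → a ≡ b mod n
≡⇒≡mod refl = 0 , 0 , refl

≡mod-sym : ∀ {a b n} → a ≡ b mod n → b ≡ a mod n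
≡mod-sym (i , j , eq) = j , i , sym eq

≡mod-trans : ∀ {a b c n} → a ≡ b mod n → b ≡ c mod n → a ≡ c mod n
≡mod-trans {a} {b} {c} {n} (i , j , a≡b) (k , l , b≡c) = i + k , l + j , (begin
  a + (i + k) * n      ≡⟨ shift a i k n ⟩
  (a + i * n) + k * n  ≡⟨ cong (_+ k * n) a≡b ⟩
  (b + j * n) + k * n  ≡⟨ swap b j k n ⟩
  (b + k * n) + j * n  ≡⟨ cong (_+ j * n) b≡c ⟩
  (c + l * n) + j * n  ≡⟨ shift c l j n ⟨
  c + (l + j) * n      ∎)
  where
  open ≡-Reasoning
  shift : ∀ a i k n → a + (i + k) * n ≡ (a + i * n) + k * n
  shift = solve-∀
  swap : ∀ b j k n → (b + j * n) + k * n ≡ (b + k * n) + j * n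
  swap = solve-∀

≡mod-+ : ∀ {a b c d n} → a ≡ b mod n → c ≡ d mod n → a + c ≡ b + d mod n
≡mod-+ {a} {b} {c} {d} {n} (i , j , a≡b) (k , l , c≡d) = i + k , j + l , (begin
  a + c + (i + k) * n          ≡⟨ shuffle a c i k n ⟩
  (a + i * n) + (c + k * n)    ≡⟨ cong₂ _+_ a≡b c≡d ⟩
  (b + j * n) + (d + l * n)    ≡⟨ shuffle b d j l n ⟨
  b + d + (j + l) * n          ∎)
  where
  open ≡-Reasoning
  shuffle : ∀ a c i k n → a + c + (i + k) * n ≡ (a + i * n) + (c + k * n)
  shuffle = solve-∀

a+kn≡a-mod : ∀ a k n → a + k * n ≡ a mod n
a+kn≡a-mod a k n = 0 , k , +-identityʳ _

≡mod-∣ : ∀ {a b d n} → d ∣ n → a ≡ b mod n → a ≡ b mod d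
≡mod-∣ {a} {b} {d} (divides q refl) (i , j , eq) = i * q , j * q ,
  trans (cong (a +_) (*-assoc i q d)) (trans eq (cong (b +_) (sym (*-assoc j q d))))

≡mod⇒≡ : ∀ {a b n} → a < n → b < n → a ≡ b mod n → a ≡ b
≡mod⇒≡ {a} {b} {n} a<n b<n (i , j , eq) = begin
  a                  ≡⟨ m<n⇒m%n≡m a<n ⟨
  a % n              ≡⟨ [m+kn]%n≡m%n a i n ⟨
  (a + i * n) % n    ≡⟨ cong (_% n) eq ⟩
  (b + j * n) % n    ≡⟨ [m+kn]%n≡m%n b j n ⟩
  b % n              ≡⟨ m<n⇒m%n≡m b<n ⟩
  b                  ∎
  where
  open ≡-Reasoning
  instance _ = >-nonZero (≤-<-trans z≤n a<n)

coprime-∣ˡ : ∀ {d m n} → d ∣ m → Coprime m n → Coprime d n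
coprime-∣ˡ d∣m m⊥n (c∣d , c∣n) = m⊥n (∣-trans c∣d d∣m , c∣n)

coprime-∣ʳ : ∀ {d m n} → d ∣ n → Coprime m n → Coprime m d
coprime-∣ʳ d∣n m⊥n = Coprime.sym (coprime-∣ˡ d∣n (Coprime.sym m⊥n))

coprime-*ˡ : ∀ {m n o} → Coprime m o → Coprime n o → Coprime (m * n) o
coprime-*ˡ m⊥o n⊥o (d∣mn , d∣o) = n⊥o (coprime-divisor (coprime-∣ˡ d∣o (Coprime.sym m⊥o)) d∣mn , d∣o)

≡mod-coprime : ∀ {a b n} → a ≡ b mod n → Coprime b n → Coprime a n
≡mod-coprime {a} {b} {n} (i , j , eq) b⊥n {d} (d∣a , d∣n) = b⊥n (d∣b , d∣n)
  where
  d∣b+jn : d ∣ b + j * n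
  d∣b+jn = subst (d ∣_) eq (∣m∣n⇒∣m+n d∣a (∣n⇒∣m*n i d∣n))
  d∣b : d ∣ b
  d∣b = ∣m+n∣m⇒∣n (subst (d ∣_) (+-comm b (j * n)) d∣b+jn) (∣n⇒∣m*n j d∣n)

inverse-mod : ∀ {k n} → Coprime k n → ∃ λ k′ → k * k′ ≡ 1 mod n
inverse-mod {k} {n} k⊥n with coprime-Bézout k⊥n
... | Bézout.+- x y eq = x , 0 , y , trans (+-identityʳ _) (trans (*-comm k x) (sym eq))
inverse-mod {k} {zero}  k⊥n | Bézout.-+ x y eq = contradiction (trans eq (*-zeroʳ y)) λ ()
inverse-mod {k} {suc n} k⊥n | Bézout.-+ x y eq = x * n , y , x * k , (begin
  k * (x * n) + y * suc n      ≡⟨ cong (k * (x * n) +_) eq ⟨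
  k * (x * n) + (1 + x * k)    ≡⟨ rearrange k x n ⟩
  1 + x * k * suc n            ∎)
  where
  open ≡-Reasoning
  rearrange : ∀ k x n → k * (x * n) + (1 + x * k) ≡ 1 + x * k * suc n
  rearrange = solve-∀

crt : ∀ {n₁ n₂} → Coprime n₁ n₂ → .{{NonZero n₂}} → ∀ m → ∃ λ t → m + t * n₁ ≡ 1 mod n₂
crt {n₁} {suc n} n₁⊥n₂ m with inverse-mod n₁⊥n₂
... | t₀ , i , j , eq = t₀ * w , i * w , m + j * w , (begin
  m + t₀ * w * n₁ + i * w * suc n     ≡⟨ factor m t₀ w n₁ i n ⟩
  m + (n₁ * t₀ + i * suc n) * w       ≡⟨ cong (λ v → m + v * w) eq ⟩
  m + (1 + j * suc n) * w             ≡⟨ regroup m j n ⟩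
  1 + (m + j * w) * suc n             ∎)
  where
  open ≡-Reasoning
  w = n * m + 1
  factor : ∀ m t₀ w n₁ i n → m + t₀ * w * n₁ + i * w * suc n ≡ m + (n₁ * t₀ + i * suc n) * w
  factor = solve-∀
  regroup : ∀ m j n → m + (1 + j * suc n) * (n * m + 1) ≡ 1 + (m + j * (n * m + 1)) * suc n
  regroup = solve-∀

record Split (a n : ℕ) : Set where
  field
    n₁ n₂        : ℕ
    n≡n₁*n₂      : n ≡ n₁ * n₂
    n₂⊥a         : Coprime n₂ a
    n₁-primes∣a  : ∀ {c} → Coprime a c → Coprime n₁ c

split : ∀ a n → .{{NonZero n}} → Split a n
split a = <-rec (λ n → .{{NonZero n}} → Split a n) step
  where
  step : ∀ n → (∀ {m} → m < n → .{{NonZero m}} → Split a m) → .{{NonZero n}} → Split a n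
  step n rec with coprime? n a
  ... | yes n⊥a = record
    { n₁ = 1 ; n₂ = n ; n≡n₁*n₂ = sym (*-identityˡ n) ; n₂⊥a = n⊥a
    ; n₁-primes∣a = λ _ → Coprime.1-coprimeTo _ }
  ... | no ¬n⊥a = record
    { n₁ = d * n₁ ; n₂ = n₂ ; n≡n₁*n₂ = n≡ ; n₂⊥a = n₂⊥a
    ; n₁-primes∣a = λ a⊥c → coprime-*ˡ (coprime-∣ˡ (gcd[m,n]∣n n a) a⊥c) (n₁-primes∣a a⊥c) }
    where
    d = gcd n a
    d∣n = gcd[m,n]∣m n a
    d>1 : 1 < d
    d>1 with gcd n a | gcd[m,n]≡0⇒m≡0 {n} {a} | gcd≡1⇒coprime {n} {a}
    ... | zero          | d≡0⇒n≡0 | _        = contradiction (d≡0⇒n≡0 refl) (≢-nonZero⁻¹ n)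
    ... | suc zero      | _       | d≡1⇒n⊥a = ⊥-elim (¬n⊥a (d≡1⇒n⊥a refl))
    ... | suc (suc _)   | _       | _        = s≤s (s≤s z≤n)
    instance
      _ = n>1⇒nonTrivial d>1
      _ = quotient≢0 d∣n
    open Split (rec (quotient-< d∣n))
    n≡ : n ≡ d * n₁ * n₂
    n≡ = trans (m∣n⇒n≡m*quotient d∣n) (trans (cong (d *_) n≡n₁*n₂) (sym (*-assoc d n₁ n₂)))

coprime-lift : ∀ {a b n k} → .{{NonZero n}} → Coprime a b → a ∣ n → b ∣ n → Coprime k n →
              ∃ λ m → Coprime m n × m ≡ k mod a × m ≡ 1 mod b
coprime-lift {a} {b} {n} {k} a⊥b a∣n b∣n k⊥n = m , m⊥n , ≡mod-∣ a∣n₁ m≡k , ≡mod-∣ b∣n₂ m≡1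
  where
  open Split (split a n)
  a∣n₁ : a ∣ n₁
  a∣n₁ = coprime-divisor (Coprime.sym n₂⊥a) (subst (a ∣_) (trans n≡n₁*n₂ (*-comm n₁ n₂)) a∣n)
  b∣n₂ : b ∣ n₂
  b∣n₂ = coprime-divisor (Coprime.sym (n₁-primes∣a a⊥b)) (subst (b ∣_) n≡n₁*n₂ b∣n)
  instance
    _ : NonZero n₂
    _ = ≢-nonZero λ n₂≡0 → ≢-nonZero⁻¹ n (trans n≡n₁*n₂ (trans (cong (n₁ *_) n₂≡0) (*-zeroʳ n₁)))
  n₁⊥n₂ : Coprime n₁ n₂
  n₁⊥n₂ = n₁-primes∣a (Coprime.sym n₂⊥a)
  t = proj₁ (crt n₁⊥n₂ k)
  m = k + t * n₁
  m≡k : m ≡ k mod n₁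
  m≡k = a+kn≡a-mod k t n₁
  m≡1 : m ≡ 1 mod n₂
  m≡1 = proj₂ (crt n₁⊥n₂ k)
  m⊥n₁ : Coprime m n₁
  m⊥n₁ = ≡mod-coprime m≡k (coprime-∣ʳ (divides n₂ (trans n≡n₁*n₂ (*-comm n₁ n₂))) k⊥n)
  m⊥n₂ : Coprime m n₂
  m⊥n₂ = ≡mod-coprime m≡1 (Coprime.1-coprimeTo n₂)
  m⊥n : Coprime m n
  m⊥n = subst (Coprime m) (sym n≡n₁*n₂) (Coprime.sym (coprime-*ˡ (Coprime.sym m⊥n₁) (Coprime.sym m⊥n₂)))

coprime-suc : ∀ n → Coprime n (suc n)
coprime-suc n {d} (d∣n , d∣1+n) = ∣1⇒≡1 (∣m+n∣m⇒∣n (subst (d ∣_) (+-comm 1 n) d∣1+n) d∣n)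

coprime-primes : ∀ {p q} → Prime p → Prime q → p ≢ q → Coprime p q
coprime-primes pp pq p≢q {d} (d∣p , d∣q) with prime⇒irreducible pp d∣p
... | inj₁ d≡1 = d≡1
... | inj₂ refl with prime⇒irreducible pq d∣q
...   | inj₁ p≡1 = contradiction (subst Prime p≡1 pp) ¬prime[1]
...   | inj₂ p≡q = contradiction p≡q p≢q

fin2-≢⇒≡ : ∀ {a b c : Fin 2} → a ≢ c → b ≢ c → a ≡ b
fin2-≢⇒≡ {zero}     {zero}     _   _   = refl
fin2-≢⇒≡ {suc zero} {suc zero} _   _   = refl
fin2-≢⇒≡ {zero}     {suc zero} {zero}     a≢c _   = contradiction refl a≢c
fin2-≢⇒≡ {zero}     {suc zero} {suc zero} _   b≢c = contradiction refl b≢c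
fin2-≢⇒≡ {suc zero} {zero}     {zero}     _   b≢c = contradiction refl b≢c
fin2-≢⇒≡ {suc zero} {zero}     {suc zero} a≢c _   = contradiction refl a≢c

two-values⇒≡2 : ∀ {r} {i₀ i₁ : Fin r} → i₀ ≢ i₁ → (∀ j → j ≡ i₀ ⊎ j ≡ i₁) → r ≡ 2
two-values⇒≡2 {r} {i₀} {i₁} i₀≢i₁ cover =
  ≤-antisym (injective⇒≤ classify-injective) (injective⇒≤ pick-injective)
  where
  pick : Fin 2 → Fin r
  pick zero    = i₀
  pick (suc _) = i₁
  classify : Fin r → Fin 2
  classify j = [ const zero , const (suc zero) ] (cover j)
  pick∘classify : ∀ j → pick (classify j) ≡ j
  pick∘classify j with cover j
  ... | inj₁ j≡i₀ = sym j≡i₀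
  ... | inj₂ j≡i₁ = sym j≡i₁
  classify-injective : ∀ {j j′} → classify j ≡ classify j′ → j ≡ j′
  classify-injective {j} {j′} eq = trans (sym (pick∘classify j)) (trans (cong pick eq) (pick∘classify j′))
  pick-injective : ∀ {a b} → pick a ≡ pick b → a ≡ b
  pick-injective {zero}     {zero}     _     = refl
  pick-injective {zero}     {suc zero} i₀≡i₁ = contradiction i₀≡i₁ i₀≢i₁
  pick-injective {suc zero} {zero}     i₁≡i₀ = contradiction (sym i₁≡i₀) i₀≢i₁
  pick-injective {suc zero} {suc zero} _     = refl

module Powers (G : FinAbGroup) where

  open FinAbGroup G using (_∙_; ε; _⁻¹; _^_; _^ℤ_)

  abelianGroup : AbelianGroup 0ℓ 0ℓ
  abelianGroup = record
    { Carrier = Carrier G ; _≈_ = _≡_ ; _∙_ = _∙_ ; ε = ε ; _⁻¹ = _⁻¹ ; isAbelianGroup = isAbelianGroup G }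

  open AbelianGroup abelianGroup public using (group; commutativeMonoid; assoc; comm; identityˡ; identityʳ)
  open import Algebra.Properties.Group group using (inverseʳ-unique)
  open import Algebra.Properties.CommutativeMonoid.Mult commutativeMonoid
    using (×-homo-+; ×-assocˡ) renaming (_×_ to _×ᵍ_)

  ^≡× : ∀ x n → x ^ n ≡ n ×ᵍ x
  ^≡× x zero    = refl
  ^≡× x (suc n) = cong (x ∙_) (^≡× x n)

  ^-+ : ∀ x m n → x ^ (m + n) ≡ x ^ m ∙ x ^ n
  ^-+ x m n rewrite ^≡× x (m + n) | ^≡× x m | ^≡× x n = ×-homo-+ x m n

  ^-* : ∀ x m n → x ^ (m * n) ≡ (x ^ m) ^ n
  ^-* x m n rewrite ^≡× x (m * n) | ^≡× x m | ^≡× (m ×ᵍ x) n | *-comm m n = sym (×-assocˡ x n m)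

  ^-^-comm : ∀ x m n → (x ^ m) ^ n ≡ (x ^ n) ^ m
  ^-^-comm x m n = trans (sym (^-* x m n)) (trans (cong (x ^_) (*-comm m n)) (^-* x n m))

  ε-^ : ∀ n → ε ^ n ≡ ε
  ε-^ zero    = refl
  ε-^ (suc n) = trans (identityˡ _) (ε-^ n)

  ^-*-ε : ∀ {x n} k → x ^ n ≡ ε → x ^ (k * n) ≡ ε
  ^-*-ε {x} {n} k xⁿ≡ε = trans (cong (x ^_) (*-comm k n)) (trans (^-* x n k) (trans (cong (_^ k) xⁿ≡ε) (ε-^ k)))

  ^-cong-mod : ∀ {x n i j} → x ^ n ≡ ε → i ≡ j mod n → x ^ i ≡ x ^ j
  ^-cong-mod {x} {n} {i} {j} xⁿ≡ε (k , l , eq) = begin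
    x ^ i                  ≡⟨ identityʳ _ ⟨
    x ^ i ∙ ε              ≡⟨ cong (x ^ i ∙_) (^-*-ε k xⁿ≡ε) ⟨
    x ^ i ∙ x ^ (k * n)    ≡⟨ ^-+ x i (k * n) ⟨
    x ^ (i + k * n)        ≡⟨ cong (x ^_) eq ⟩
    x ^ (j + l * n)        ≡⟨ ^-+ x j (l * n) ⟩
    x ^ j ∙ x ^ (l * n)    ≡⟨ cong (x ^ j ∙_) (^-*-ε l xⁿ≡ε) ⟩
    x ^ j ∙ ε              ≡⟨ identityʳ _ ⟩
    x ^ j                  ∎
    where open ≡-Reasoning

  order∣ : ∀ {x a n} → IsElemOrder G x a → x ^ n ≡ ε → a ∣ n
  order∣ {x} {a} {n} (0<a , xᵃ≡ε , minimal) xⁿ≡ε = m%n≡0⇒n∣m n a (n%a≡0 (n % a) refl)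
    where
    instance _ = >-nonZero 0<a
    n%a≡n : n % a ≡ n mod a
    n%a≡n = n / a , 0 , trans (sym (m≡m%n+[m/n]*n n a)) (sym (+-identityʳ n))
    x^[n%a]≡ε : x ^ (n % a) ≡ ε
    x^[n%a]≡ε = trans (^-cong-mod xᵃ≡ε n%a≡n) xⁿ≡ε
    n%a≡0 : ∀ r → n % a ≡ r → r ≡ 0
    n%a≡0 zero    _  = refl
    n%a≡0 (suc r) eq = contradiction (subst (_< a) eq (m%n<n n a))
                         (≤⇒≯ (minimal (suc r) z<s (subst (λ m → x ^ m ≡ ε) eq x^[n%a]≡ε)))

  prime-order : ∀ {x p} → Prime p → x ≢ ε → x ^ p ≡ ε → IsElemOrder G x p
  prime-order {x} {p} pp x≢ε xᵖ≡ε = >-nonZero⁻¹ p {{prime⇒nonZero pp}} , xᵖ≡ε , minimal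
    where
    minimal : ∀ j → 0 < j → x ^ j ≡ ε → p ≤ j
    minimal j 0<j xʲ≡ε with j <? p
    ... | no  j≮p = ≮⇒≥ j≮p
    ... | yes j<p with inverse-mod (Coprime.sym (prime⇒coprime pp {{>-nonZero 0<j}} j<p))
    ...   | j′ , jj′≡1 = contradiction (begin
      x              ≡⟨ identityʳ x ⟨
      x ^ 1          ≡⟨ ^-cong-mod xᵖ≡ε (≡mod-sym jj′≡1) ⟩
      x ^ (j * j′)   ≡⟨ ^-* x j j′ ⟩
      (x ^ j) ^ j′   ≡⟨ cong (_^ j′) xʲ≡ε ⟩
      ε ^ j′         ≡⟨ ε-^ j′ ⟩
      ε              ∎) x≢ε
      where open ≡-Reasoning

  module _ {e} (exponent : IsExponent G e) where

    private
      x^e≡ε : ∀ x → x ^ e ≡ ε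
      x^e≡ε = proj₁ (proj₂ exponent)

    ^-inverse : ∀ {k} → Coprime k e → ∃ λ k′ → Coprime k′ e × ∀ x → (x ^ k) ^ k′ ≡ x
    ^-inverse {k} k⊥e with inverse-mod k⊥e
    ... | k′ , kk′≡1 = k′ , coprime-∣ˡ (n∣m*n k) (≡mod-coprime kk′≡1 (Coprime.1-coprimeTo e)) , λ x →
      trans (sym (^-* x k k′)) (trans (^-cong-mod (x^e≡ε x) kk′≡1) (identityʳ x))

    ^ℤ-as-^ : ∀ {m} → Coprime ℤ.∣ m ∣ e → ∃ λ k → Coprime k e × ∀ x → x ^ℤ m ≡ x ^ k
    ^ℤ-as-^ {ℤ.+ n}      n⊥e = n , n⊥e , λ _ → refl
    ^ℤ-as-^ {ℤ.-[1+ n ]} n⊥e = pred e * suc n , coprime-*ˡ pred-e⊥e n⊥e , λ x →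
      trans (cong (_^ suc n) (x⁻¹≡x^pred-e x)) (sym (^-* x (pred e) (suc n)))
      where
      instance _ = >-nonZero (proj₁ exponent)
      pred-e⊥e : Coprime (pred e) e
      pred-e⊥e = subst (Coprime (pred e)) (suc-pred e) (coprime-suc (pred e))
      x⁻¹≡x^pred-e : ∀ x → x ⁻¹ ≡ x ^ pred e
      x⁻¹≡x^pred-e x = sym (inverseʳ-unique x (x ^ pred e) (trans (cong (x ^_) (suc-pred e)) (x^e≡ε x)))

module GroupSemiring (G : FinAbGroup) where

  open FinAbGroup G using (_∙_; ε; _⁻¹; _^_; _≟_)
  open Powers G using (group; assoc; comm; identityˡ)
  open import Algebra.Properties.Group group
    using (y≈x\\z; \\-leftDividesˡ; \\-leftDividesʳ; ⁻¹-anti-homo-∙; ε⁻¹≈ε)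

  private
    E = elems G

  δ : Carrier G → Carrier G → ℕ
  δ x y = χ (x ≟ y)

  ∑-δ-elems : ∀ F a → ∑[ x ∈ E ] (δ a x * F x) ≡ F a
  ∑-δ-elems F a = ∑-δ _≟_ F (unique G) (complete G a)

  δ-sym : ∀ x y → δ x y ≡ δ y x
  δ-sym x y = χ-cong sym sym (x ≟ y) (y ≟ x)

  δ-translate : ∀ x y z → δ (x ∙ y) z ≡ δ (x ⁻¹ ∙ z) y
  δ-translate x y z = χ-cong (λ xy≡z → sym (y≈x\\z x y z xy≡z))
                             (λ x⁻¹z≡y → trans (cong (x ∙_) (sym x⁻¹z≡y)) (\\-leftDividesˡ x z))
                             ((x ∙ y) ≟ z) ((x ⁻¹ ∙ z) ≟ y)

  ∑-translate : ∀ x F → ∑[ y ∈ E ] F (x ∙ y) ≡ ∑ E F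
  ∑-translate x F = begin
    ∑[ y ∈ E ] F (x ∙ y)                          ≡⟨ ∑-cong E (λ y → sym (∑-δ-elems F (x ∙ y))) ⟩
    ∑[ y ∈ E ] ∑[ w ∈ E ] (δ (x ∙ y) w * F w)     ≡⟨ ∑-comm E E _ ⟩
    ∑[ w ∈ E ] ∑[ y ∈ E ] (δ (x ∙ y) w * F w)     ≡⟨ ∑-cong E (λ w → sym (*-distribʳ-∑ (F w) E _)) ⟩
    ∑[ w ∈ E ] ((∑[ y ∈ E ] δ (x ∙ y) w) * F w)   ≡⟨ ∑-cong E (λ w → cong (_* F w) (∑-δ-translate w)) ⟩
    ∑[ w ∈ E ] (1 * F w)                          ≡⟨ ∑-cong E (λ w → *-identityˡ (F w)) ⟩
    ∑ E F                                         ∎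
    where
    open ≡-Reasoning
    ∑-δ-translate : ∀ w → ∑[ y ∈ E ] δ (x ∙ y) w ≡ 1
    ∑-δ-translate w = trans (∑-cong E (λ y → trans (δ-translate x y w) (sym (*-identityʳ _))))
                            (∑-δ-elems (λ _ → 1) (x ⁻¹ ∙ w))

  -- f : ℕ[G] stands for the formal sum Σ f(x)·x, and _⋆_ is the product of such sums.
  ℕ[G] : Set
  ℕ[G] = Carrier G → ℕ

  infixl 6 _⊕_
  infixl 7 _⋆_

  _⊕_ : ℕ[G] → ℕ[G] → ℕ[G]
  (f ⊕ g) x = f x + g x

  𝟘 : ℕ[G]
  𝟘 _ = 0

  𝟙 : ℕ[G]
  𝟙 = δ ε

  _⋆_ : ℕ[G] → ℕ[G] → ℕ[G]
  (f ⋆ g) z = ∑[ x ∈ E ] ∑[ y ∈ E ] (f x * g y * δ (x ∙ y) z)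

  ⋆-apply : ∀ f g z → (f ⋆ g) z ≡ ∑[ x ∈ E ] (f x * g (x ⁻¹ ∙ z))
  ⋆-apply f g z = ∑-cong E λ x → begin
    ∑[ y ∈ E ] (f x * g y * δ (x ∙ y) z)         ≡⟨ ∑-cong E (λ y → trans (*-assoc (f x) (g y) _)
                                                      (cong (f x *_) (swap (g y) (δ-translate x y z)))) ⟩
    ∑[ y ∈ E ] (f x * (δ (x ⁻¹ ∙ z) y * g y))    ≡⟨ *-distribˡ-∑ (f x) E _ ⟨
    f x * ∑[ y ∈ E ] (δ (x ⁻¹ ∙ z) y * g y)      ≡⟨ cong (f x *_) (∑-δ-elems g (x ⁻¹ ∙ z)) ⟩
    f x * g (x ⁻¹ ∙ z)                           ∎
    where
    open ≡-Reasoning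
    swap : ∀ c {a b} → a ≡ b → c * a ≡ b * c
    swap c {a} refl = *-comm c a

  ⋆-cong : ∀ {f f′ g g′} → f ≗ f′ → g ≗ g′ → f ⋆ g ≗ f′ ⋆ g′
  ⋆-cong f≗f′ g≗g′ z =
    ∑-cong E λ x → ∑-cong E λ y → cong₂ (λ a b → a * b * δ (x ∙ y) z) (f≗f′ x) (g≗g′ y)

  ⋆-comm : ∀ f g → f ⋆ g ≗ g ⋆ f
  ⋆-comm f g z = trans (∑-comm E E _) (∑-cong E λ y → ∑-cong E λ x →
    cong₂ _*_ (*-comm (f x) (g y)) (cong (λ w → δ w z) (comm x y)))

  ⋆-identityˡ : ∀ f → 𝟙 ⋆ f ≗ f
  ⋆-identityˡ f z = begin
    (𝟙 ⋆ f) z                             ≡⟨ ⋆-apply 𝟙 f z ⟩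
    ∑[ x ∈ E ] (δ ε x * f (x ⁻¹ ∙ z))     ≡⟨ ∑-δ-elems (λ x → f (x ⁻¹ ∙ z)) ε ⟩
    f (ε ⁻¹ ∙ z)                          ≡⟨ cong f (trans (cong (_∙ z) ε⁻¹≈ε) (identityˡ z)) ⟩
    f z                                   ∎
    where open ≡-Reasoning

  ⋆-assoc : ∀ f g h → (f ⋆ g) ⋆ h ≗ f ⋆ (g ⋆ h)
  ⋆-assoc f g h z = begin
    ((f ⋆ g) ⋆ h) z
      ≡⟨ ⋆-apply (f ⋆ g) h z ⟩
    ∑[ w ∈ E ] ((f ⋆ g) w * h (w ⁻¹ ∙ z))
      ≡⟨ ∑-cong E (λ w → trans (cong (_* h (w ⁻¹ ∙ z)) (⋆-apply f g w)) (*-distribʳ-∑ _ E _)) ⟩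
    ∑[ w ∈ E ] ∑[ x ∈ E ] (f x * g (x ⁻¹ ∙ w) * h (w ⁻¹ ∙ z))
      ≡⟨ ∑-comm E E _ ⟩
    ∑[ x ∈ E ] ∑[ w ∈ E ] (f x * g (x ⁻¹ ∙ w) * h (w ⁻¹ ∙ z))
      ≡⟨ ∑-cong E (λ x → sym (∑-translate x _)) ⟩
    ∑[ x ∈ E ] ∑[ y ∈ E ] (f x * g (x ⁻¹ ∙ (x ∙ y)) * h ((x ∙ y) ⁻¹ ∙ z))
      ≡⟨ ∑-cong E (λ x → ∑-cong E λ y → trans (*-assoc (f x) _ _)
           (cong₂ (λ u v → f x * (g u * h v)) (\\-leftDividesʳ x y) (inverse-∙ x y))) ⟩
    ∑[ x ∈ E ] ∑[ y ∈ E ] (f x * (g y * h (y ⁻¹ ∙ (x ⁻¹ ∙ z))))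
      ≡⟨ ∑-cong E (λ x → trans (sym (*-distribˡ-∑ (f x) E _))
                                (cong (f x *_) (sym (⋆-apply g h (x ⁻¹ ∙ z))))) ⟩
    ∑[ x ∈ E ] (f x * (g ⋆ h) (x ⁻¹ ∙ z))
      ≡⟨ ⋆-apply f (g ⋆ h) z ⟨
    (f ⋆ (g ⋆ h)) z
      ∎
    where
    open ≡-Reasoning
    inverse-∙ : ∀ x y → (x ∙ y) ⁻¹ ∙ z ≡ y ⁻¹ ∙ (x ⁻¹ ∙ z)
    inverse-∙ x y = trans (cong (_∙ z) (⁻¹-anti-homo-∙ x y)) (assoc (y ⁻¹) (x ⁻¹) z)

  ⋆-zeroˡ : ∀ f → 𝟘 ⋆ f ≗ 𝟘
  ⋆-zeroˡ f z = trans (∑-cong E λ x → ∑-zero E) (∑-zero E)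

  ⋆-distribʳ : ∀ f g h → (g ⊕ h) ⋆ f ≗ g ⋆ f ⊕ h ⋆ f
  ⋆-distribʳ f g h z =
    trans (∑-cong E λ x → trans (∑-cong E λ y → distrib (g x) (h x) (f y) (δ (x ∙ y) z)) (∑-distrib-+ E _ _))
          (∑-distrib-+ E _ _)
    where
    distrib : ∀ a b c d → (a + b) * c * d ≡ a * c * d + b * c * d
    distrib = solve-∀

  commutativeSemiring : CommutativeSemiring 0ℓ 0ℓ
  commutativeSemiring = record
    { Carrier = ℕ[G] ; _≈_ = _≗_ ; _+_ = _⊕_ ; _*_ = _⋆_ ; 0# = 𝟘 ; 1# = 𝟙
    ; isCommutativeSemiring = isCommutativeSemiringˡ record
      { +-isCommutativeMonoid = Pointwise.isCommutativeMonoid (Carrier G) +-0-isCommutativeMonoid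
      ; *-isCommutativeMonoid = isCommutativeMonoidˡ record
        { isSemigroup = record
          { isMagma = record
            { isEquivalence = Pointwise.isEquivalence (Carrier G) ≡-isEquivalence ; ∙-cong = ⋆-cong }
          ; assoc = ⋆-assoc }
        ; identityˡ = ⋆-identityˡ
        ; comm = ⋆-comm }
      ; distribʳ = ⋆-distribʳ
      ; zeroˡ = ⋆-zeroˡ } }

  open CommutativeSemiring commutativeSemiring using (semiring; +-monoid)
  open import Algebra.Properties.Semiring.Exp semiring public using () renaming (_^_ to _^⋆_)
  open import Algebra.Properties.Semiring.Exp semiring using (^-congˡ)
  open import Algebra.Properties.Monoid.Mult +-monoid using () renaming (_×_ to _·_)
  open FreshmansDream commutativeSemiring using (freshmansDream)

  ·-apply : ∀ n f z → (n · f) z ≡ n * f z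
  ·-apply zero    f z = refl
  ·-apply (suc n) f z = cong (f z +_) (·-apply n f z)

  ^⋆-⊕-mod : ∀ {p} → Prime p → ∀ u v z → ((u ⊕ v) ^⋆ p) z ≡ (u ^⋆ p) z + (v ^⋆ p) z mod p
  ^⋆-⊕-mod {p} pp u v z with freshmansDream pp u v
  ... | w , dream = 0 , w z ,
    trans (+-identityʳ _) (trans (dream z) (cong (_ +_) (trans (·-apply p w z) (*-comm p (w z)))))

  𝟘-^⋆ : ∀ n → .{{NonZero n}} → 𝟘 ^⋆ n ≗ 𝟘
  𝟘-^⋆ (suc n) = ⋆-zeroˡ (𝟘 ^⋆ n)

  monomial : ℕ → Carrier G → ℕ[G]
  monomial c g x = c * δ g x

  monomial-⋆ : ∀ c d g h → monomial c g ⋆ monomial d h ≗ monomial (c * d) (g ∙ h)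
  monomial-⋆ c d g h z = begin
    (monomial c g ⋆ monomial d h) z                  ≡⟨ ⋆-apply (monomial c g) (monomial d h) z ⟩
    ∑[ x ∈ E ] (c * δ g x * (d * δ h (x ⁻¹ ∙ z)))    ≡⟨ ∑-cong E (λ x → rearrange c (δ g x) d _) ⟩
    ∑[ x ∈ E ] (δ g x * (c * d * δ h (x ⁻¹ ∙ z)))    ≡⟨ ∑-δ-elems _ g ⟩
    c * d * δ h (g ⁻¹ ∙ z)                           ≡⟨ cong (c * d *_) (trans (δ-translate g h z) (δ-sym _ h)) ⟨
    c * d * δ (g ∙ h) z                              ∎
    where
    open ≡-Reasoning
    rearrange : ∀ c a d b → c * a * (d * b) ≡ a * (c * d * b)
    rearrange = solve-∀

  monomial-^⋆ : ∀ c g n → monomial c g ^⋆ n ≗ monomial (c ℕ.^ n) (g ^ n)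
  monomial-^⋆ c g zero    x = sym (*-identityˡ (δ ε x))
  monomial-^⋆ c g (suc n) x =
    trans (⋆-cong {monomial c g} (λ _ → refl) (monomial-^⋆ c g n) x) (monomial-⋆ c _ g _ x)

  expand : List (Carrier G) → ℕ[G] → ℕ[G]
  expand []       f = 𝟘
  expand (g ∷ gs) f = monomial (f g) g ⊕ expand gs f

  expand-elems : ∀ f → expand E f ≗ f
  expand-elems f x =
    trans (expand-apply E) (trans (∑-cong E λ g → trans (*-comm (f g) _) (cong (_* f g) (δ-sym g x)))
                                  (∑-δ-elems f x))
    where
    expand-apply : ∀ gs → expand gs f x ≡ ∑[ g ∈ gs ] (f g * δ g x)
    expand-apply []       = refl
    expand-apply (g ∷ gs) = cong (f g * δ g x +_) (expand-apply gs)

  frobenius : ∀ {p} → Prime p → ∀ f z → (f ^⋆ p) z ≡ ∑[ g ∈ E ] (f g ℕ.^ p * δ (g ^ p) z) mod p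
  frobenius {p} pp f z = ≡mod-trans (≡⇒≡mod (^-congˡ p (λ x → sym (expand-elems f x)) z)) (frobenius-expand E)
    where
    frobenius-expand : ∀ gs → (expand gs f ^⋆ p) z ≡ ∑[ g ∈ gs ] (f g ℕ.^ p * δ (g ^ p) z) mod p
    frobenius-expand []       = ≡⇒≡mod (𝟘-^⋆ p {{prime⇒nonZero pp}} z)
    frobenius-expand (g ∷ gs) = ≡mod-trans (^⋆-⊕-mod pp (monomial (f g) g) (expand gs f) z)
                                           (≡mod-+ (≡⇒≡mod (monomial-^⋆ (f g) g p z)) (frobenius-expand gs))

module Cauchy (G : FinAbGroup) where

  open FinAbGroup G using (_∙_; ε; _⁻¹; _^_; _≟_)
  open Powers G using (ε-^)
  open GroupSemiring G

  private
    E = elems G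

  ones : ℕ[G]
  ones _ = 1

  ones-^⋆ : ∀ n z → (ones ^⋆ suc n) z ≡ order G ℕ.^ n
  ones-^⋆ zero    z = trans (⋆-comm ones 𝟙 z) (⋆-identityˡ ones z)
  ones-^⋆ (suc n) z = begin
    (ones ⋆ ones ^⋆ suc n) z                      ≡⟨ ⋆-apply ones (ones ^⋆ suc n) z ⟩
    ∑[ x ∈ E ] (1 * (ones ^⋆ suc n) (x ⁻¹ ∙ z))  ≡⟨ ∑-cong E (λ _ → trans (*-identityˡ _) (ones-^⋆ n _)) ⟩
    ∑[ x ∈ E ] (order G ℕ.^ n)              ≡⟨ ∑-const E _ ⟩
    order G ℕ.^ suc n                       ∎
    where open ≡-Reasoning

  cauchy : ∀ {p} → Prime p → p ∣ order G → ∃ λ x → x ≢ ε × x ^ p ≡ ε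
  cauchy {0} pp _ = contradiction pp ¬prime[0]
  cauchy {1} pp _ = contradiction pp ¬prime[1]
  cauchy {p@(suc (suc q))} pp p∣|G| with any? (λ x → ¬? (x ≟ ε) ×-dec ((x ^ p) ≟ ε)) E
  ... | yes witness = satisfied witness
  ... | no ∄witness = contradiction (≡mod⇒≡ z<s (s<s z<s) 0≡1) λ ()
    where
    only-ε : ∀ x → x ^ p ≡ ε → x ≡ ε
    only-ε x xᵖ≡ε with x ≟ ε
    ... | yes x≡ε = x≡ε
    ... | no  x≢ε = contradiction (lose (complete G x) (x≢ε , xᵖ≡ε)) ∄witness
    count : ∑[ x ∈ E ] (1 ℕ.^ p * δ (x ^ p) ε) ≡ 1
    count = trans (∑-cong E λ x → trans (cong₂ _*_ (^-zeroˡ p) (δ-root x)) (*-comm 1 _))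
                  (∑-δ-elems (λ _ → 1) ε)
      where
      δ-root : ∀ x → δ (x ^ p) ε ≡ δ ε x
      δ-root x = χ-cong (λ xᵖ≡ε → sym (only-ε x xᵖ≡ε)) (λ ε≡x → trans (cong (_^ p) (sym ε≡x)) (ε-^ p))
                        ((x ^ p) ≟ ε) (ε ≟ x)
    |G|ᵖ⁻¹≡0 : order G ℕ.^ suc q ≡ 0 mod p
    |G|ᵖ⁻¹≡0 with ∣m⇒∣m*n (order G ℕ.^ q) p∣|G|
    ... | divides c eq = 0 , c , trans (+-identityʳ _) eq
    0≡1 : 0 ≡ 1 mod p
    0≡1 = ≡mod-trans (≡mod-sym |G|ᵖ⁻¹≡0)
            (≡mod-trans (≡⇒≡mod (sym (ones-^⋆ (suc q) ε)))
              (≡mod-trans (frobenius pp ones ε) (≡⇒≡mod count)))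

module SRingProperties (G : FinAbGroup) (A : SRing G) where

  open FinAbGroup G using (_∙_; ε; _^_; _≟_)
  open Powers G using (^-*; ^-^-comm; ε-^; identityʳ; ^-cong-mod; order∣; ^-inverse; ^ℤ-as-^)
  open GroupSemiring G

  private
    E = elems G
    I = allFin (rank A)

  IsClassFunction : ℕ[G] → Set
  IsClassFunction f = ∀ z z′ → basic A z ≡ basic A z′ → f z ≡ f z′

  χ[_] : Fin (rank A) → ℕ[G]
  χ[ i ] x = χ (basic A x Fin.≟ i)

  rep : Fin (rank A) → Carrier G
  rep i = proj₁ (basic-surj A i)

  χ-classFunction : ∀ i → IsClassFunction χ[ i ]
  χ-classFunction i z z′ κz≡κz′ = χ-cong (trans (sym κz≡κz′)) (trans κz≡κz′) _ _

  classFunction-expand : ∀ {f} → IsClassFunction f → ∀ x → f x ≡ ∑[ i ∈ I ] (f (rep i) * χ[ i ] x)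
  classFunction-expand {f} f-class x = sym (begin
    ∑[ i ∈ I ] (f (rep i) * χ[ i ] x)                 ≡⟨ ∑-cong I (λ i → *-comm (f (rep i)) _) ⟩
    ∑[ i ∈ I ] (χ (basic A x Fin.≟ i) * f (rep i))    ≡⟨ ∑-δ Fin._≟_ (f ∘ rep) (allFin⁺ _) (∈-allFin _) ⟩
    f (rep (basic A x))                               ≡⟨ f-class _ x (proj₂ (basic-surj A (basic A x))) ⟩
    f x                                               ∎)
    where open ≡-Reasoning

  ∑-by-class : ∀ {f} → IsClassFunction f → ∀ u →
               ∑[ x ∈ E ] (f x * u x) ≡ ∑[ i ∈ I ] (f (rep i) * ∑[ x ∈ E ] (χ[ i ] x * u x))
  ∑-by-class {f} f-class u = begin
    ∑[ x ∈ E ] (f x * u x)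
      ≡⟨ ∑-cong E (λ x → trans (*-comm (f x) (u x)) (cong (u x *_) (classFunction-expand f-class x))) ⟩
    ∑[ x ∈ E ] (u x * ∑[ i ∈ I ] (f (rep i) * χ[ i ] x))
      ≡⟨ ∑-*-exchange E I u (f ∘ rep) (λ x i → χ[ i ] x) ⟩
    ∑[ i ∈ I ] (f (rep i) * ∑[ x ∈ E ] (u x * χ[ i ] x))
      ≡⟨ ∑-cong I (λ i → cong (f (rep i) *_) (∑-cong E λ x → *-comm (u x) _)) ⟩
    ∑[ i ∈ I ] (f (rep i) * ∑[ x ∈ E ] (χ[ i ] x * u x))
      ∎
    where open ≡-Reasoning

  structConst-∑ : ∀ i j z →
    structConst G (basic A) i j z ≡ ∑[ x ∈ E ] (χ[ i ] x * ∑[ y ∈ E ] (χ[ j ] y * δ (x ∙ y) z))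
  structConst-∑ i j z = begin
    structConst G (basic A) i j z
      ≡⟨ length-filter _ (cartesianProduct E E) ⟩
    ∑[ (x , y) ∈ cartesianProduct E E ] χ ((basic A x Fin.≟ i) ×-dec ((basic A y Fin.≟ j) ×-dec ((x ∙ y) ≟ z)))
      ≡⟨ ∑-cartesianProduct E E _ ⟩
    ∑[ x ∈ E ] ∑[ y ∈ E ] χ ((basic A x Fin.≟ i) ×-dec ((basic A y Fin.≟ j) ×-dec ((x ∙ y) ≟ z)))
      ≡⟨ ∑-cong E (λ x → ∑-cong E λ y → trans (χ-×-dec (basic A x Fin.≟ i) _)
                                                (cong (χ[ i ] x *_) (χ-×-dec (basic A y Fin.≟ j) ((x ∙ y) ≟ z)))) ⟩
    ∑[ x ∈ E ] ∑[ y ∈ E ] (χ[ i ] x * (χ[ j ] y * δ (x ∙ y) z))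
      ≡⟨ ∑-cong E (λ x → *-distribˡ-∑ (χ[ i ] x) E _) ⟨
    ∑[ x ∈ E ] (χ[ i ] x * ∑[ y ∈ E ] (χ[ j ] y * δ (x ∙ y) z))
      ∎
    where open ≡-Reasoning

  ⋆-structConst : ∀ {f g} → IsClassFunction f → IsClassFunction g → ∀ z →
    (f ⋆ g) z ≡ ∑[ i ∈ I ] (f (rep i) * ∑[ j ∈ I ] (g (rep j) * structConst G (basic A) i j z))
  ⋆-structConst {f} {g} f-class g-class z = begin
    ∑[ x ∈ E ] ∑[ y ∈ E ] (f x * g y * δ (x ∙ y) z)
      ≡⟨ ∑-cong E (λ x → trans (∑-cong E λ y → *-assoc (f x) (g y) _) (sym (*-distribˡ-∑ (f x) E _))) ⟩
    ∑[ x ∈ E ] (f x * ∑[ y ∈ E ] (g y * δ (x ∙ y) z))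
      ≡⟨ ∑-by-class f-class _ ⟩
    ∑[ i ∈ I ] (f (rep i) * ∑[ x ∈ E ] (χ[ i ] x * ∑[ y ∈ E ] (g y * δ (x ∙ y) z)))
      ≡⟨ ∑-cong I (λ i → cong (f (rep i) *_)
           (trans (∑-*-exchange E E χ[ i ] g (λ x y → δ (x ∙ y) z)) (∑-by-class g-class _))) ⟩
    ∑[ i ∈ I ] (f (rep i) * ∑[ j ∈ I ] (g (rep j) * ∑[ y ∈ E ] (χ[ j ] y * ∑[ x ∈ E ] (χ[ i ] x * δ (x ∙ y) z))))
      ≡⟨ ∑-cong I (λ i → cong (f (rep i) *_) (∑-cong I λ j → cong (g (rep j) *_)
           (trans (∑-*-exchange E E χ[ j ] χ[ i ] (λ y x → δ (x ∙ y) z)) (sym (structConst-∑ i j z))))) ⟩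
    ∑[ i ∈ I ] (f (rep i) * ∑[ j ∈ I ] (g (rep j) * structConst G (basic A) i j z))
      ∎
    where open ≡-Reasoning

  ⋆-classFunction : ∀ {f g} → IsClassFunction f → IsClassFunction g → IsClassFunction (f ⋆ g)
  ⋆-classFunction {f} {g} f-class g-class z z′ κz≡κz′ = begin
    (f ⋆ g) z
      ≡⟨ ⋆-structConst f-class g-class z ⟩
    ∑[ i ∈ I ] (f (rep i) * ∑[ j ∈ I ] (g (rep j) * structConst G (basic A) i j z))
      ≡⟨ ∑-cong I (λ i → cong (f (rep i) *_) (∑-cong I λ j →
           cong (g (rep j) *_) (mult-closed A i j z z′ κz≡κz′))) ⟩
    ∑[ i ∈ I ] (f (rep i) * ∑[ j ∈ I ] (g (rep j) * structConst G (basic A) i j z′))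
      ≡⟨ ⋆-structConst f-class g-class z′ ⟨
    (f ⋆ g) z′
      ∎
    where open ≡-Reasoning

  𝟙-classFunction : IsClassFunction 𝟙
  𝟙-classFunction z z′ κz≡κz′ = χ-cong (λ ε≡z → sym (in-identity z′ (trans (sym κz≡κz′) (cong (basic A) (sym ε≡z)))))
                                       (λ ε≡z′ → sym (in-identity z (trans κz≡κz′ (cong (basic A) (sym ε≡z′)))))
                                       (ε ≟ z) (ε ≟ z′)
    where in-identity = identity-basic A

  ^⋆-classFunction : ∀ {f} → IsClassFunction f → ∀ n → IsClassFunction (f ^⋆ n)
  ^⋆-classFunction f-class zero    = 𝟙-classFunction
  ^⋆-classFunction f-class (suc n) = ⋆-classFunction f-class (^⋆-classFunction f-class n)

  Multiplier : ℕ → Set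
  Multiplier k = ∀ z z′ → basic A z ≡ basic A z′ → basic A (z ^ k) ≡ basic A (z′ ^ k)

  multiplier-1 : Multiplier 1
  multiplier-1 z z′ κz≡κz′ =
    trans (cong (basic A) (identityʳ z)) (trans κz≡κz′ (cong (basic A) (sym (identityʳ z′))))

  multiplier-* : ∀ {k l} → Multiplier k → Multiplier l → Multiplier (k * l)
  multiplier-* {k} {l} k-mult l-mult z z′ κz≡κz′ = begin
    basic A (z ^ (k * l))     ≡⟨ cong (basic A) (^-* z k l) ⟩
    basic A ((z ^ k) ^ l)     ≡⟨ l-mult _ _ (k-mult z z′ κz≡κz′) ⟩
    basic A ((z′ ^ k) ^ l)    ≡⟨ cong (basic A) (^-* z′ k l) ⟨
    basic A (z′ ^ (k * l))    ∎
    where open ≡-Reasoning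

  multiplier-cong : ∀ {k l} → (∀ x → x ^ k ≡ x ^ l) → Multiplier k → Multiplier l
  multiplier-cong k~l k-mult z z′ κz≡κz′ =
    trans (cong (basic A) (sym (k~l z))) (trans (k-mult z z′ κz≡κz′) (cong (basic A) (k~l z′)))

  inverse-of-prime-multiplier : ∀ {p k} → Prime p → (∀ x → (x ^ p) ^ k ≡ x) → Multiplier k
  inverse-of-prime-multiplier {p@(suc q)} {k} pp inverse z z′ κz≡κz′ =
    sym (χ≡1⇒ (basic A (z′ ^ k) Fin.≟ i) (trans (sym (≡mod⇒≡ (χ<p _) (χ<p _) congruence)) (χ-yes refl _)))
    where
    i = basic A (z ^ k)
    χ<p : ∀ {P : Set} (P? : Dec P) → χ P? < p
    χ<p P? = <-≤-trans (χ<2 P?) (nonTrivial⇒n>1 p {{prime⇒nonTrivial pp}})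
    δ-root : ∀ g w → δ (g ^ p) w ≡ δ (w ^ k) g
    δ-root g w = χ-cong (λ gᵖ≡w → trans (cong (_^ k) (sym gᵖ≡w)) (inverse g))
                        (λ wᵏ≡g → trans (cong (_^ p) (sym wᵏ≡g)) (trans (^-^-comm w k p) (inverse w)))
                        ((g ^ p) ≟ w) ((w ^ k) ≟ g)
    frobenius-χ : ∀ w → (χ[ i ] ^⋆ p) w ≡ χ[ i ] (w ^ k) mod p
    frobenius-χ w = ≡mod-trans (frobenius pp χ[ i ] w) (≡⇒≡mod (begin
      ∑[ g ∈ E ] (χ[ i ] g ℕ.^ p * δ (g ^ p) w)
        ≡⟨ ∑-cong E (λ g → trans (cong₂ _*_ (χ-^ (basic A g Fin.≟ i) q) (δ-root g w)) (*-comm (χ[ i ] g) _)) ⟩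
      ∑[ g ∈ E ] (δ (w ^ k) g * χ[ i ] g)
        ≡⟨ ∑-δ-elems χ[ i ] (w ^ k) ⟩
      χ[ i ] (w ^ k)
        ∎))
      where open ≡-Reasoning
    congruence : χ[ i ] (z ^ k) ≡ χ[ i ] (z′ ^ k) mod p
    congruence = ≡mod-trans (≡mod-sym (frobenius-χ z))
                   (≡mod-trans (≡⇒≡mod (^⋆-classFunction (χ-classFunction i) p z z′ κz≡κz′))
                               (frobenius-χ z′))

  module _ {e} (exponent : IsExponent G e) where

    private
      x^e≡ε : ∀ x → x ^ e ≡ ε
      x^e≡ε = proj₁ (proj₂ exponent)

    MultiplierInverse : ℕ → Set
    MultiplierInverse n = ∃ λ c → Multiplier c × ∀ x → (x ^ n) ^ c ≡ x

    prime-product-inverse : ∀ ps → All Prime ps → Coprime (product ps) e → MultiplierInverse (product ps)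
    prime-product-inverse []       _          _   = 1 , multiplier-1 , λ x → trans (identityʳ _) (identityʳ x)
    prime-product-inverse (p ∷ ps) (pp ∷ pps) ∏⊥e
      with ^-inverse exponent (coprime-∣ˡ (m∣m*n {p} (product ps)) ∏⊥e)
         | prime-product-inverse ps pps (coprime-∣ˡ (n∣m*n p) ∏⊥e)
    ... | c₁ , _ , p-inverse | c , c-mult , ps-inverse = c₁ * c , c₁c-mult , λ x → begin
      (x ^ (p * product ps)) ^ (c₁ * c)  ≡⟨ cong (_^ (c₁ * c)) (trans (cong (x ^_) (*-comm p _)) (^-* x (product ps) p)) ⟩
      ((x ^ product ps) ^ p) ^ (c₁ * c)  ≡⟨ ^-* _ c₁ c ⟩
      (((x ^ product ps) ^ p) ^ c₁) ^ c  ≡⟨ cong (_^ c) (p-inverse _) ⟩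
      (x ^ product ps) ^ c               ≡⟨ ps-inverse x ⟩
      x                                  ∎
      where
      open ≡-Reasoning
      c₁c-mult : Multiplier (c₁ * c)
      c₁c-mult = multiplier-* {c₁} {c} (inverse-of-prime-multiplier {p} {c₁} pp p-inverse) c-mult

    inverse-multiplier : ∀ n → Coprime n e → MultiplierInverse n
    inverse-multiplier zero      0⊥e = 1 , multiplier-1 , λ x → trans (identityʳ ε) (sym (trivial x))
      where
      trivial : ∀ x → x ≡ ε
      trivial x = trans (sym (identityʳ x)) (trans (cong (x ^_) (sym (0-coprimeTo-m⇒m≡1 0⊥e))) (x^e≡ε x))
    inverse-multiplier n@(suc _) n⊥e =
      subst MultiplierInverse (sym isFactorisation)
            (prime-product-inverse factors factorsPrime (subst (λ m → Coprime m e) isFactorisation n⊥e))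
      where open PrimeFactorisation (factorise n)

    coprime⇒multiplier : ∀ {k} → Coprime k e → Multiplier k
    coprime⇒multiplier {k} k⊥e with ^-inverse exponent k⊥e
    ... | k′ , k′⊥e , k-inverse with inverse-multiplier k′ k′⊥e
    ...   | c , c-mult , k′-inverse =
      multiplier-cong {c} {k} (λ x → trans (cong (_^ c) (sym (k-inverse x))) (k′-inverse (x ^ k))) c-mult

    coprime-orders⇒power-closed : ∀ {i x y a b} → basic A x ≡ i → basic A y ≡ i →
      IsElemOrder G x a → IsElemOrder G y b → Coprime a b →
      ∀ {k} → Coprime k e → ∀ w → basic A w ≡ i → basic A (w ^ k) ≡ i
    coprime-orders⇒power-closed {i} {x} {y} {a} {b} x∈i y∈i x-order y-order a⊥b {k} k⊥e w w∈i
      with coprime-lift {{>-nonZero (proj₁ exponent)}} a⊥b (order∣ x-order (x^e≡ε x)) (order∣ y-order (x^e≡ε y))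
                        k⊥e
    ... | m , m⊥e , m≡k , m≡1 = begin
      basic A (w ^ k)   ≡⟨ coprime⇒multiplier k⊥e w x (trans w∈i (sym x∈i)) ⟩
      basic A (x ^ k)   ≡⟨ cong (basic A) (^-cong-mod (proj₁ (proj₂ x-order)) m≡k) ⟨
      basic A (x ^ m)   ≡⟨ coprime⇒multiplier m⊥e x y (trans x∈i (sym y∈i)) ⟩
      basic A (y ^ m)   ≡⟨ cong (basic A) (trans (^-cong-mod (proj₁ (proj₂ y-order)) m≡1) (identityʳ y)) ⟩
      basic A y         ≡⟨ y∈i ⟩
      i                 ∎
      where open ≡-Reasoning

    coprime-orders⇒rational : ∀ {i x y a b} → basic A x ≡ i → basic A y ≡ i →
      IsElemOrder G x a → IsElemOrder G y b → Coprime a b → IsRational A e i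
    coprime-orders⇒rational x∈i y∈i x-order y-order a⊥b m m⊥e with ^ℤ-as-^ exponent {m} m⊥e
    ... | k , k⊥e , ^ℤ≡^ with ^-inverse exponent k⊥e
    ...   | k′ , k′⊥e , k-inverse =
      (λ w w∈i → trans (cong (basic A) (^ℤ≡^ w)) (closed k⊥e w w∈i)) ,
      (λ w w∈i → w ^ k′ , closed k′⊥e w w∈i , trans (^ℤ≡^ (w ^ k′)) (trans (^-^-comm w k′ k) (k-inverse w)))
      where
      closed = coprime-orders⇒power-closed x∈i y∈i x-order y-order a⊥b

    join⇒power : ∀ {x y} → Join A e x y → ∃ λ k → Coprime k e × basic A y ≡ basic A (x ^ k)
    join⇒power {x} (join-A κx≡κy) =
      1 , Coprime.1-coprimeTo e , trans (sym κx≡κy) (cong (basic A) (sym (identityʳ x)))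
    join⇒power {x} (join-W (m , m⊥e , y≡x^m)) with ^ℤ-as-^ exponent {m} m⊥e
    ... | k , k⊥e , ^ℤ≡^ = k , k⊥e , cong (basic A) (trans y≡x^m (^ℤ≡^ x))
    join⇒power {x} {y} (join-sym y~x) with join⇒power y~x
    ... | k , k⊥e , κx≡κyᵏ with ^-inverse exponent k⊥e
    ...   | k′ , k′⊥e , k-inverse = k′ , k′⊥e , (begin
      basic A y                  ≡⟨ cong (basic A) (k-inverse y) ⟨
      basic A ((y ^ k) ^ k′)     ≡⟨ coprime⇒multiplier k′⊥e (y ^ k) x (sym κx≡κyᵏ) ⟩
      basic A (x ^ k′)           ∎)
      where open ≡-Reasoning
    join⇒power {x} {z} (join-trans {y = y} x~y y~z) with join⇒power x~y | join⇒power y~z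
    ... | k , k⊥e , κy≡κxᵏ | l , l⊥e , κz≡κyˡ = k * l , coprime-*ˡ k⊥e l⊥e , (begin
      basic A z                  ≡⟨ κz≡κyˡ ⟩
      basic A (y ^ l)            ≡⟨ coprime⇒multiplier l⊥e y (x ^ k) κy≡κxᵏ ⟩
      basic A ((x ^ k) ^ l)      ≡⟨ cong (basic A) (^-* x k l) ⟨
      basic A (x ^ (k * l))      ∎)
      where open ≡-Reasoning

    join-ε : ∀ {y} → Join A e ε y → y ≡ ε
    join-ε {y} ε~y with join⇒power ε~y
    ... | k , _ , κy≡κεᵏ = identity-basic A y (trans κy≡κεᵏ (cong (basic A) (ε-^ k)))

module RationalClosure (G : FinAbGroup) (A : SRing G) {e} (exponent : IsExponent G e) where

  open FinAbGroup G using (ε; _^_; _≟_)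
  open Powers G using (^-^-comm; ε-^; prime-order)
  open SRingProperties G A
  open Cauchy G using (cauchy)

  nonidentity-join : RationalClosureRank A e 2 → ∀ {u w} → u ≢ ε → w ≢ ε → Join A e u w
  nonidentity-join (f , _ , f⇒join , _) u≢ε w≢ε = f⇒join _ _ (fin2-≢⇒≡ (separated u≢ε) (separated w≢ε))
    where
    separated : ∀ {u} → u ≢ ε → f u ≢ f ε
    separated u≢ε fu≡fε = u≢ε (join-ε exponent (f⇒join ε _ (sym fu≡fε)))

  rank≡2 : (Σ ℕ λ p → Σ ℕ λ q → Prime p × Prime q × p ≢ q × p ∣ order G × q ∣ order G) →
           RationalClosureRank A e 2 → rank A ≡ 2
  rank≡2 (p , q , pp , pq , p≢q , p∣|G| , q∣|G|) closure
    with cauchy pp p∣|G| | cauchy pq q∣|G|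
  ... | x₀ , x₀≢ε , x₀ᵖ≡ε | y₀ , y₀≢ε , y₀^q≡ε
    with join⇒power exponent (nonidentity-join closure x₀≢ε y₀≢ε)
  ... | k , k⊥e , κy₀≡κx₀ᵏ = two-values⇒≡2 κε≢κy₀ cover
    where
    κε≢κy₀ : basic A ε ≢ basic A y₀
    κε≢κy₀ κε≡κy₀ = y₀≢ε (identity-basic A y₀ (sym κε≡κy₀))
    x₀ᵏ≢ε : x₀ ^ k ≢ ε
    x₀ᵏ≢ε x₀ᵏ≡ε = κε≢κy₀ (sym (trans κy₀≡κx₀ᵏ (cong (basic A) x₀ᵏ≡ε)))
    X-rational : IsRational A e (basic A y₀)
    X-rational = coprime-orders⇒rational exponent (sym κy₀≡κx₀ᵏ) refl
      (prime-order pp x₀ᵏ≢ε (trans (^-^-comm x₀ k p) (trans (cong (_^ k) x₀ᵖ≡ε) (ε-^ k))))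
      (prime-order pq y₀≢ε y₀^q≡ε)
      (coprime-primes pp pq p≢q)
    cover : ∀ j → j ≡ basic A ε ⊎ j ≡ basic A y₀
    cover j with basic-surj A j
    ... | w , refl with w ≟ ε
    ...   | yes w≡ε = inj₁ (cong (basic A) w≡ε)
    ...   | no  w≢ε with join⇒power exponent (nonidentity-join closure y₀≢ε w≢ε)
    ...     | l , l⊥e , κw≡κy₀ˡ = inj₂ (trans κw≡κy₀ˡ (proj₁ (X-rational (ℤ.+ l) l⊥e) y₀ refl))

lemma6p1 :
    ((G : FinAbGroup) (A : SRing G) (e : ℕ) → IsExponent G e →
      (i : Fin (rank A)) (x y : Carrier G) → basic A x ≡ i → basic A y ≡ i →
      (a b : ℕ) → IsElemOrder G x a → IsElemOrder G y b → Coprime a b →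
      IsRational A e i)
    ×
    ((G : FinAbGroup) →
      (Σ ℕ λ p → Σ ℕ λ q → Prime p × Prime q × p ≢ q × p ∣ order G × q ∣ order G) →
      (A : SRing G) (e : ℕ) → IsExponent G e →
      RationalClosureRank A e 2 → rank A ≡ 2)
lemma6p1 =
  (λ G A e exponent i x y x∈i y∈i a b x-order y-order a⊥b →
     SRingProperties.coprime-orders⇒rational G A exponent x∈i y∈i x-order y-order a⊥b) ,
  (λ G two-primes A e exponent closure-rank → RationalClosure.rank≡2 G A exponent two-primes closure-rank)
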